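{- Let $j^{\operatorname{last}}_{m,k}(321)$ be the number of $321$-avoiding Jacobi permutations $\pi\in\mathfrak{S}_m$ whose last letter equals $k$. For all $n\geq1$, \[ j^{\operatorname{last}}_{2n,k}(321)=\begin{cases}\dfrac{2n-k}{n}\dbinom{k-1}{n-1}, & \text{if } n\leq k\leq 2n-1,\\ 0, & \text{otherwise},\end{cases} \] and \[ j^{\operatorname{last}}_{2n+1,k}(321)=\begin{cases}\dfrac{2n-k+1}{n}\dbinom{k-2}{n-1}, & \text{if } n+1\leq k\leq 2n,\\ 0, & \text{otherwise}.\end{cases} \]
   Context: A permutation of a finite set $S$ of positive integers is a word in which each element of $S$ appears exactly once; $\mathfrak{S}_m$ is the set of permutations of $\{1,\dots,m\}$. For a permutation $\pi$ and a letter $x$ of $\pi$, $\rho_\pi(x)$ is the maximal consecutive subword of $\pi$ consisting of the letters immediately to the right of $x$ that are all larger than $x$. $\pi$ is Jacobi if $|\rho_\pi(x)|$ is even for all letters $x$. A permutation $\pi$ avoids a pattern $\sigma$ if no subword of $\pi$ has standardization (relative order) $\sigma$. -}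

module Defs where

open import Data.Nat using (ℕ; suc; _<_; _<?_; _*_; _∸_; _+_; _≤_)
open import Data.Nat.Divisibility using (_∣_)
open import Data.List using (List; []; _∷_; length; takeWhile; applyUpTo; last)
open import Data.List.Relation.Binary.Permutation.Propositional using (_↭_)
open import Data.List.Relation.Binary.Sublist.Propositional using (_⊆_)
open import Data.List.Relation.Unary.Unique.Propositional using (Unique)
open import Data.List.Membership.Propositional using (_∈_)
open import Data.Maybe using (Maybe; just)
open import Data.Product using (Σ; _×_; ∃)
open import Data.Unit using (⊤)
open import Relation.Nullary using (¬_)
open import Relation.Binary.PropositionalEquality using (_≡_)
open import Function.Bundles using (_⇔_)

[1‥_] : ℕ → List ℕ
[1‥ m ] = applyUpTo suc m

IsPerm : ℕ → List ℕ → Set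
IsPerm m π = π ↭ [1‥ m ]

-- ρ_π(x) for the letter x followed by the word xs: the maximal run of letters
-- immediately to the right of x that are all larger than x.
ρ : ℕ → List ℕ → List ℕ
ρ x xs = takeWhile (x <?_) xs

Jacobi : List ℕ → Set
Jacobi []       = ⊤
Jacobi (x ∷ xs) = (2 ∣ length (ρ x xs)) × Jacobi xs

Avoids321 : List ℕ → Set
Avoids321 π = ¬ (Σ ℕ λ a → Σ ℕ λ b → Σ ℕ λ c →
                  ((a ∷ b ∷ c ∷ []) ⊆ π) × (c < b) × (b < a))

JLast : ℕ → ℕ → List ℕ → Set
JLast m k π = IsPerm m π × Avoids321 π × Jacobi π × (last π ≡ just k)

HasCard : (List ℕ → Set) → ℕ → Set
HasCard P N = Σ (List (List ℕ)) λ L → Unique L × (∀ π → (π ∈ L) ⇔ P π) × (length L ≡ N)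

-- Deleting the last two letters gives a recurrence. In a 321-avoiding Jacobi permutation of
-- 1 … m+2 ending in k, the letter a before k exceeds k (otherwise ρ(a) = k would have odd
-- length) and equals m+2 (otherwise m+2, a, k is a 321). Removing a and k and standardising
-- leaves a 321-avoiding Jacobi permutation of 1 … m whose last letter is below k; conversely,
-- shifting the values ≥ k of such a permutation up by one and appending m+2, k preserves both
-- properties. Hence j(m+2,k) = Σ_{b<k} j(m,b) for 1 ≤ k ≤ m+1, and 0 otherwise. For even
-- lengths this is solved by the ballot numbers j(2n,k) = C(k-1,n-1) − C(k-1,n), which the
-- absorption identity turns into the stated closed form; odd lengths satisfy
-- j(2n+1,k+1) = j(2n,k), by induction through the same recurrence.

module Submission where

open import Defs
open import Data.Nat using (ℕ; _≤_; _*_; _∸_; _+_; suc)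
open import Data.Nat.Combinatorics using (_C_)
open import Data.Product using (Σ; _×_)
open import Relation.Nullary using (¬_)
open import Relation.Binary.PropositionalEquality using (_≡_)

open import Data.Nat using (zero; pred; _<_; z≤n; s≤s; s<s)
open import Data.Nat.Properties
open import Data.Nat.Divisibility using (_∣_; divides; ∣m∣n⇒∣m+n; ∣m+n∣m⇒∣n)
open import Data.Nat.Combinatorics using (nCk+nC[k+1]≡[n+1]C[k+1]; nC1≡n; nCk≡nC[n∸k])
open import Data.Nat.Combinatorics.Specification using (k>n⇒nCk≡0)
open import Algebra.Properties.CommutativeSemigroup +-commutativeSemigroup using (interchange)
open import Data.List using (List; []; _∷_; length; map; _++_; takeWhile; last)
open import Data.List.Properties
  using (length-map; length-++; ++-identityʳ; map-∘; map-id-local; map-injective; ++-cancelʳ)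
open import Data.List.Relation.Unary.Any using (here; there)
open import Data.List.Relation.Unary.All as All using (All; []; _∷_; all?)
import Data.List.Relation.Unary.All.Properties as All
open import Data.List.Relation.Unary.AllPairs using ([]; _∷_)
open import Data.List.Relation.Unary.Unique.Propositional using (Unique)
open import Data.List.Relation.Unary.Unique.Propositional.Properties using (applyUpTo⁺₁)
  renaming (map⁺ to Unique-map⁺; map⁻ to Unique-map⁻; ++⁺ to Unique-++⁺)
open import Data.List.Relation.Binary.Disjoint.Propositional using (Disjoint)
open import Data.List.Relation.Binary.Sublist.Propositional as Sublist
  using (_⊆_; []; _∷_; _∷ʳ_; ⊆-refl; ⊆-trans)
import Data.List.Relation.Binary.Sublist.Propositional.Properties as Sublistₚ
open import Data.List.Membership.Propositional using (_∈_)
open import Data.List.Membership.Propositional.Properties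
  using (∈-applyUpTo⁺; ∈-applyUpTo⁻; ∈-++⁻; ∈-++⁺ˡ; ∈-++⁺ʳ; ∈-map⁻; ∈-map⁺)
open import Data.List.Membership.Propositional.Properties.WithK using (unique∧set⇒bag)
open import Data.List.Relation.Binary.BagAndSetEquality using (∼bag⇒↭)
open import Data.List.Relation.Binary.Permutation.Propositional using (_↭_; ↭-sym; ↭-refl; ↭⇒↭ₛ)
open import Data.List.Relation.Binary.Permutation.Propositional.Properties
  using (∈-resp-↭; ↭-length; ↭-empty-inv; ↭-singleton-inv)
open import Data.Maybe using (just)
open import Data.Maybe.Properties using (just-injective)
open import Data.Product using (_,_; proj₁; proj₂; ∃; ∃₂; uncurry; map₂)
open import Data.Product.Function.NonDependent.Propositional using (_×-⇔_)
open import Data.Sum using (inj₁; inj₂)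
open import Data.Unit using (tt)
open import Data.Empty using (⊥-elim)
open import Function using (_∘_)
open import Function.Bundles using (_⇔_; mk⇔; Equivalence)
open import Function.Construct.Identity using (⇔-id)
open import Relation.Binary.Core using (_Preserves_⟶_)
open import Relation.Binary.Definitions using (tri<; tri≈; tri>)
open import Relation.Binary.PropositionalEquality
  using (_≢_; refl; sym; trans; cong; cong₂; subst; setoid; module ≡-Reasoning)
open import Relation.Nullary using (yes; no; _×-dec_)
open import Relation.Unary using (Decidable)

open import Data.List.Relation.Binary.Permutation.Setoid.Properties (setoid ℕ) using (Unique-resp-↭)

last-∷ : ∀ (y : ℕ) σ → ∃ λ j → last (y ∷ σ) ≡ just j
last-∷ y [] = y , refl
last-∷ _ (z ∷ σ) = last-∷ z σ

last∈ : ∀ (σ : List ℕ) {j} → last σ ≡ just j → j ∈ σ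
last∈ (_ ∷ []) refl = here refl
last∈ (_ ∷ y ∷ σ) last≡j = there (last∈ (y ∷ σ) last≡j)

last-++-∷-∷ : ∀ (σ : List ℕ) a b → last (σ ++ a ∷ b ∷ []) ≡ just b
last-++-∷-∷ [] a b = refl
last-++-∷-∷ (_ ∷ []) a b = refl
last-++-∷-∷ (_ ∷ y ∷ σ) a b = last-++-∷-∷ (y ∷ σ) a b

∷⊆⇒last : ∀ {x xs} σ → x ∷ xs ⊆ σ → ∃ λ j → last σ ≡ just j
∷⊆⇒last (y ∷ σ) _ = last-∷ y σ

∷-∷-as-++ : ∀ (x y : ℕ) r → ∃ λ σ → ∃₂ λ a b → x ∷ y ∷ r ≡ σ ++ a ∷ b ∷ []
∷-∷-as-++ x y [] = [] , x , y , refl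
∷-∷-as-++ x y (z ∷ r) with ∷-∷-as-++ y z r
... | σ , a , b , eq = x ∷ σ , a , b , cong (x ∷_) eq

⊆-map⁻ : ∀ (f : ℕ → ℕ) {xs} ys → xs ⊆ map f ys → ∃ λ zs → zs ⊆ ys × map f zs ≡ xs
⊆-map⁻ f [] [] = [] , [] , refl
⊆-map⁻ f (y ∷ ys) (_ ∷ʳ xs⊆) with ⊆-map⁻ f ys xs⊆
... | zs , zs⊆ , refl = zs , y ∷ʳ zs⊆ , refl
⊆-map⁻ f (y ∷ ys) (refl ∷ xs⊆) with ⊆-map⁻ f ys xs⊆
... | zs , zs⊆ , refl = y ∷ zs , refl ∷ zs⊆ , refl

⊆-++-split : ∀ {xs} (ys zs : List ℕ) → xs ⊆ ys ++ zs →
  ∃₂ λ xs₁ xs₂ → xs ≡ xs₁ ++ xs₂ × xs₁ ⊆ ys × xs₂ ⊆ zs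
⊆-++-split [] zs xs⊆ = [] , _ , refl , [] , xs⊆
⊆-++-split (y ∷ ys) zs (.y ∷ʳ xs⊆) with ⊆-++-split ys zs xs⊆
... | xs₁ , xs₂ , refl , xs₁⊆ , xs₂⊆ = xs₁ , xs₂ , refl , y ∷ʳ xs₁⊆ , xs₂⊆
⊆-++-split (y ∷ ys) zs (refl ∷ xs⊆) with ⊆-++-split ys zs xs⊆
... | xs₁ , xs₂ , refl , xs₁⊆ , xs₂⊆ = y ∷ xs₁ , xs₂ , refl , refl ∷ xs₁⊆ , xs₂⊆

⊆-++-last : ∀ {xs j} σ → xs ⊆ σ → last σ ≡ just j → All (j <_) xs → xs ++ j ∷ [] ⊆ σ
⊆-++-last (y ∷ []) (.y ∷ʳ []) refl [] = refl ∷ []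
⊆-++-last (y ∷ []) (refl ∷ []) refl (j<j ∷ []) = ⊥-elim (<-irrefl refl j<j)
⊆-++-last (y ∷ z ∷ σ) (.y ∷ʳ xs⊆) last≡j j<xs = y ∷ʳ ⊆-++-last (z ∷ σ) xs⊆ last≡j j<xs
⊆-++-last (y ∷ z ∷ σ) (refl ∷ xs⊆) last≡j (_ ∷ j<xs) = refl ∷ ⊆-++-last (z ∷ σ) xs⊆ last≡j j<xs

∈⇒∷-++-⊆ : ∀ {x : ℕ} {σ} t → x ∈ σ → x ∷ t ⊆ σ ++ t
∈⇒∷-++-⊆ t x∈σ = Sublistₚ.++⁺ (Sublist.from∈ x∈σ) ⊆-refl

Unique-++⁻ : ∀ xs {ys : List ℕ} → Unique (xs ++ ys) → Unique xs × Unique ys × Disjoint xs ys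
Unique-++⁻ [] unique-ys = [] , unique-ys , λ ()
Unique-++⁻ (x ∷ xs) (x∉ ∷ unique) with Unique-++⁻ xs unique
... | unique-xs , unique-ys , disjoint =
  All.++⁻ˡ xs x∉ ∷ unique-xs , unique-ys ,
  λ { (here refl , x∈ys) → All.lookup (All.++⁻ʳ xs x∉) x∈ys refl
    ; (there v∈xs , v∈ys) → disjoint (v∈xs , v∈ys) }

∈-++-peak⁻ : ∀ {x A k : ℕ} σ → x ∈ σ ++ A ∷ k ∷ [] → x ≢ A → x ≢ k → x ∈ σ
∈-++-peak⁻ σ x∈ x≢A x≢k with ∈-++⁻ σ x∈
... | inj₁ x∈σ = x∈σ
... | inj₂ (here x≡A) = ⊥-elim (x≢A x≡A)
... | inj₂ (there (here x≡k)) = ⊥-elim (x≢k x≡k)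

module _ {P : ℕ → Set} (P? : Decidable P) where

  takeWhile-accept : ∀ {y} ys → P y → takeWhile P? (y ∷ ys) ≡ y ∷ takeWhile P? ys
  takeWhile-accept {y} ys py with P? y
  ... | yes _ = refl
  ... | no ¬py = ⊥-elim (¬py py)

  takeWhile-reject : ∀ {y} ys → ¬ P y → takeWhile P? (y ∷ ys) ≡ []
  takeWhile-reject {y} ys ¬py with P? y
  ... | yes py = ⊥-elim (¬py py)
  ... | no _ = refl

∣-+2⇔ : ∀ n → 2 ∣ n + 2 ⇔ 2 ∣ n
∣-+2⇔ n = mk⇔ (λ 2∣n+2 → ∣m+n∣m⇒∣n (subst (2 ∣_) (+-comm n 2) 2∣n+2) (divides 1 refl))
              (λ 2∣n → ∣m∣n⇒∣m+n 2∣n (divides 1 refl))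

¬2∣1 : ¬ 2 ∣ 1
¬2∣1 (divides zero ())
¬2∣1 (divides (suc q) ())

ρ-∷-< : ∀ {x y} ys → x < y → ρ x (y ∷ ys) ≡ y ∷ ρ x ys
ρ-∷-< {x} = takeWhile-accept (x <?_)

ρ-∷-≮ : ∀ {x y} ys → ¬ x < y → ρ x (y ∷ ys) ≡ []
ρ-∷-≮ {x} = takeWhile-reject (x <?_)

ρ-++ : ∀ {x s} t → All (x <_) s → ρ x (s ++ t) ≡ s ++ ρ x t
ρ-++ t [] = refl
ρ-++ {s = y ∷ s} t (x<y ∷ x<s) = trans (ρ-∷-< (s ++ t) x<y) (cong (y ∷_) (ρ-++ t x<s))

ρ-all : ∀ {x s} → All (x <_) s → ρ x s ≡ s
ρ-all {x} {s} x<s = begin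
  ρ x s         ≡⟨ cong (ρ x) (++-identityʳ s) ⟨
  ρ x (s ++ []) ≡⟨ ρ-++ [] x<s ⟩
  s ++ []       ≡⟨ ++-identityʳ s ⟩
  s             ∎
  where open ≡-Reasoning

ρ-++-stop : ∀ {x} s t → ¬ All (x <_) s → ρ x (s ++ t) ≡ ρ x s
ρ-++-stop [] t ¬x<s = ⊥-elim (¬x<s [])
ρ-++-stop {x} (y ∷ s) t ¬x<ys with x <? y
... | no x≮y = trans (ρ-∷-≮ (s ++ t) x≮y) (sym (ρ-∷-≮ s x≮y))
... | yes x<y = begin
  ρ x (y ∷ s ++ t)  ≡⟨ ρ-∷-< (s ++ t) x<y ⟩
  y ∷ ρ x (s ++ t)  ≡⟨ cong (y ∷_) (ρ-++-stop s t (λ x<s → ¬x<ys (x<y ∷ x<s))) ⟩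
  y ∷ ρ x s         ≡⟨ ρ-∷-< s x<y ⟨
  ρ x (y ∷ s)       ∎
  where open ≡-Reasoning

module _ {f : ℕ → ℕ} (f-mono : f Preserves _<_ ⟶ _<_) where

  reflects-< : ∀ {x y} → f x < f y → x < y
  reflects-< {x} {y} fx<fy with <-cmp x y
  ... | tri< x<y _ _ = x<y
  ... | tri≈ _ refl _ = ⊥-elim (<-irrefl refl fx<fy)
  ... | tri> _ _ y<x = ⊥-elim (<-asym fx<fy (f-mono y<x))

  injective : ∀ {x y} → f x ≡ f y → x ≡ y
  injective {x} {y} fx≡fy with <-cmp x y
  ... | tri< x<y _ _ = ⊥-elim (<-irrefl fx≡fy (f-mono x<y))
  ... | tri≈ _ x≡y _ = x≡y
  ... | tri> _ _ y<x = ⊥-elim (<-irrefl (sym fx≡fy) (f-mono y<x))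

  ρ-map : ∀ x xs → ρ (f x) (map f xs) ≡ map f (ρ x xs)
  ρ-map x [] = refl
  ρ-map x (y ∷ ys) with x <? y
  ... | yes x<y = begin
    ρ (f x) (f y ∷ map f ys)  ≡⟨ ρ-∷-< (map f ys) (f-mono x<y) ⟩
    f y ∷ ρ (f x) (map f ys)  ≡⟨ cong (f y ∷_) (ρ-map x ys) ⟩
    map f (y ∷ ρ x ys)        ≡⟨ cong (map f) (ρ-∷-< ys x<y) ⟨
    map f (ρ x (y ∷ ys))      ∎
    where open ≡-Reasoning
  ... | no x≮y = trans (ρ-∷-≮ (map f ys) (x≮y ∘ reflects-<)) (cong (map f) (sym (ρ-∷-≮ ys x≮y)))

  Jacobi-map : ∀ xs → Jacobi (map f xs) ⇔ Jacobi xs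
  Jacobi-map [] = ⇔-id _
  Jacobi-map (x ∷ xs) = parity ×-⇔ Jacobi-map xs
    where
    |ρ|-map : length (ρ (f x) (map f xs)) ≡ length (ρ x xs)
    |ρ|-map = trans (cong length (ρ-map x xs)) (length-map f (ρ x xs))
    parity : 2 ∣ length (ρ (f x) (map f xs)) ⇔ 2 ∣ length (ρ x xs)
    parity = mk⇔ (subst (2 ∣_) |ρ|-map) (subst (2 ∣_) (sym |ρ|-map))

  Avoids321-map : ∀ xs → Avoids321 (map f xs) ⇔ Avoids321 xs
  Avoids321-map xs = mk⇔ to from
    where
    to : Avoids321 (map f xs) → Avoids321 xs
    to avoids (a , b , c , abc⊆ , c<b , b<a) =
      avoids (f a , f b , f c , Sublistₚ.map⁺ f abc⊆ , f-mono c<b , f-mono b<a)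
    from : Avoids321 xs → Avoids321 (map f xs)
    from avoids (_ , _ , _ , abc⊆ , c<b , b<a) with ⊆-map⁻ f xs abc⊆
    ... | a ∷ b ∷ c ∷ [] , abc⊆xs , refl = avoids (a , b , c , abc⊆xs , reflects-< c<b , reflects-< b<a)

Avoids321-⊆ : ∀ {xs ys} → xs ⊆ ys → Avoids321 ys → Avoids321 xs
Avoids321-⊆ xs⊆ys avoids (a , b , c , abc⊆xs , c<b , b<a) =
  avoids (a , b , c , ⊆-trans abc⊆xs xs⊆ys , c<b , b<a)

Avoids321-short : ∀ {π} → length π < 3 → Avoids321 π
Avoids321-short |π|<3 (_ , _ , _ , abc⊆π , _) = <⇒≱ |π|<3 (Sublistₚ.length-mono-≤ abc⊆π)

Jacobi-++⁻ʳ : ∀ σ {t} → Jacobi (σ ++ t) → Jacobi t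
Jacobi-++⁻ʳ [] jacobi = jacobi
Jacobi-++⁻ʳ (_ ∷ σ) (_ , jacobi) = Jacobi-++⁻ʳ σ jacobi

Jacobi-++-last : ∀ σ {t j} → Jacobi (σ ++ t) → last σ ≡ just j → 2 ∣ length (ρ j t)
Jacobi-++-last (_ ∷ []) (2∣ρ , _) refl = 2∣ρ
Jacobi-++-last (_ ∷ y ∷ σ) (_ , jacobi) last≡j = Jacobi-++-last (y ∷ σ) jacobi last≡j

↭⇔unique-same-elements : ∀ {xs ys : List ℕ} → Unique ys →
  (xs ↭ ys) ⇔ (Unique xs × (∀ {x} → (x ∈ xs) ⇔ (x ∈ ys)))
↭⇔unique-same-elements {xs} {ys} unique-ys = mk⇔ to from
  where
  to : xs ↭ ys → Unique xs × (∀ {x} → (x ∈ xs) ⇔ (x ∈ ys))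
  to xs↭ys = Unique-resp-↭ (↭⇒↭ₛ (↭-sym xs↭ys)) unique-ys ,
             mk⇔ (∈-resp-↭ xs↭ys) (∈-resp-↭ (↭-sym xs↭ys))
  from : Unique xs × (∀ {x} → (x ∈ xs) ⇔ (x ∈ ys)) → xs ↭ ys
  from (unique-xs , same) = ∼bag⇒↭ (unique∧set⇒bag unique-xs unique-ys same)

∈-[1‥]⇔ : ∀ {m x} → (x ∈ [1‥ m ]) ⇔ (1 ≤ x × x ≤ m)
∈-[1‥]⇔ {m} = mk⇔ to from
  where
  to : ∀ {x} → x ∈ [1‥ m ] → 1 ≤ x × x ≤ m
  to x∈ with ∈-applyUpTo⁻ suc x∈
  ... | _ , i<m , refl = s≤s z≤n , i<m
  from : ∀ {x} → 1 ≤ x × x ≤ m → x ∈ [1‥ m ]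
  from {suc x} (_ , x<m) = ∈-applyUpTo⁺ suc x<m

Unique-[1‥] : ∀ m → Unique [1‥ m ]
Unique-[1‥] m = applyUpTo⁺₁ suc m (λ i<j _ → <⇒≢ i<j ∘ suc-injective)

record IsPerm′ (m : ℕ) (π : List ℕ) : Set where
  constructor mkPerm
  field
    unique  : Unique π
    bounded : ∀ {x} → x ∈ π → 1 ≤ x × x ≤ m
    covers  : ∀ {x} → 1 ≤ x → x ≤ m → x ∈ π

IsPerm⇔IsPerm′ : ∀ {m π} → IsPerm m π ⇔ IsPerm′ m π
IsPerm⇔IsPerm′ {m} {π} = mk⇔ forward backward
  where
  open Equivalence
  forward : IsPerm m π → IsPerm′ m π
  forward π↭ with to (↭⇔unique-same-elements (Unique-[1‥] m)) π↭
  ... | unique-π , same = mkPerm unique-π (λ x∈ → to ∈-[1‥]⇔ (to same x∈))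
                                        (λ 1≤x x≤m → from same (from ∈-[1‥]⇔ (1≤x , x≤m)))
  backward : IsPerm′ m π → IsPerm m π
  backward (mkPerm unique-π bounded covers) =
    from (↭⇔unique-same-elements (Unique-[1‥] m))
      (unique-π , mk⇔ (λ x∈ → from ∈-[1‥]⇔ (bounded x∈)) (λ x∈ → uncurry covers (to ∈-[1‥]⇔ x∈)))

last-nonempty : ∀ {m π} → IsPerm (suc m) π → ∃ λ j → last π ≡ just j
last-nonempty {π = []} perm with ↭-length perm
... | ()
last-nonempty {π = x ∷ π} _ = last-∷ x π

-- Deleting the last two letters

LastBelow : ℕ → List ℕ → Set
LastBelow k σ = ∀ {j} → last σ ≡ just j → j < k

LastBelow-tail : ∀ {k x} s → LastBelow k (x ∷ s) → LastBelow k s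
LastBelow-tail [] _ ()
LastBelow-tail (_ ∷ _) below = below

All<-LastBelow : ∀ {k x} s → All (x <_) s → LastBelow k (x ∷ s) → x < k
All<-LastBelow [] [] below = below refl
All<-LastBelow (y ∷ []) (x<y ∷ []) below = <-trans x<y (below refl)
All<-LastBelow (y ∷ z ∷ s) (_ ∷ x<zs) below = All<-LastBelow (z ∷ s) x<zs below

-- A letter of σ whose run reaches the end of σ is at most last σ < k, so its run grows by
-- exactly A and k; every other run is unchanged.
Jacobi-++-peak : ∀ {A k} σ → All (_< A) σ → k < A → LastBelow k σ →
  Jacobi (σ ++ A ∷ k ∷ []) ⇔ Jacobi σ
Jacobi-++-peak {A} {k} [] [] k<A _ = mk⇔ (λ _ → tt) (λ _ → 2∣ρAk , 2∣ρk , tt)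
  where
  2∣ρAk : 2 ∣ length (ρ A (k ∷ []))
  2∣ρAk = subst (λ r → 2 ∣ length r) (sym (ρ-∷-≮ [] (<-asym k<A))) (divides 0 refl)
  2∣ρk : 2 ∣ length (ρ k [])
  2∣ρk = divides 0 refl
Jacobi-++-peak {A} {k} (x ∷ s) (x<A ∷ s<A) k<A below =
  parity ×-⇔ Jacobi-++-peak s s<A k<A (LastBelow-tail s below)
  where
  parity : 2 ∣ length (ρ x (s ++ A ∷ k ∷ [])) ⇔ 2 ∣ length (ρ x s)
  parity with all? (x <?_) s
  ... | no ¬x<s rewrite ρ-++-stop s (A ∷ k ∷ []) ¬x<s = ⇔-id _
  ... | yes x<s
    rewrite ρ-++ (A ∷ k ∷ []) x<s | ρ-∷-< (k ∷ []) x<A | ρ-∷-< [] (All<-LastBelow s x<s below)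
          | ρ-all x<s | length-++ s {A ∷ k ∷ []} = ∣-+2⇔ (length s)

LastBelow-peak : ∀ {A k} σ → All (_< A) σ → Jacobi (σ ++ A ∷ k ∷ []) → LastBelow k σ
LastBelow-peak {A} {k} σ σ<A jacobi {j} last≡j with j <? k
... | yes j<k = j<k
... | no j≮k = ⊥-elim (¬2∣1 (subst (λ r → 2 ∣ length r) ρj≡A (Jacobi-++-last σ jacobi last≡j)))
  where
  ρj≡A : ρ j (A ∷ k ∷ []) ≡ A ∷ []
  ρj≡A = trans (ρ-∷-< (k ∷ []) (All.lookup σ<A (last∈ σ last≡j))) (cong (A ∷_) (ρ-∷-≮ [] j≮k))

-- A 321 cannot use the maximum A, and one ending in k can end in last σ < k instead.
Avoids321-++-peak : ∀ {A k} σ → Avoids321 σ → All (_< A) σ → LastBelow k σ →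
  Avoids321 (σ ++ A ∷ k ∷ [])
Avoids321-++-peak {A} {k} σ avoids σ<A below (a , b , c , abc⊆ , c<b , b<a)
  with ⊆-++-split σ (A ∷ k ∷ []) abc⊆
... | _ ∷ _ ∷ _ ∷ [] , [] , refl , abc⊆σ , _ = avoids (a , b , c , abc⊆σ , c<b , b<a)
... | _ ∷ _ ∷ [] , _ ∷ [] , refl , ab⊆σ , refl ∷ _ =
  <-asym c<b (All.lookup σ<A (Sublist.lookup ab⊆σ (there (here refl))))
... | _ ∷ [] , _ ∷ _ ∷ [] , refl , a⊆σ , refl ∷ _ =
  <-asym b<a (All.lookup σ<A (Sublist.lookup a⊆σ (here refl)))
... | _ ∷ [] , _ ∷ _ ∷ [] , refl , _ , _ ∷ʳ bc⊆k = <-irrefl refl (Sublistₚ.length-mono-≤ bc⊆k)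
... | [] , _ , refl , _ , abc⊆Ak = <-irrefl refl (Sublistₚ.length-mono-≤ abc⊆Ak)
... | _ ∷ _ ∷ [] , _ ∷ [] , refl , ab⊆σ , _ ∷ʳ (refl ∷ []) with ∷⊆⇒last σ ab⊆σ
...   | j , last≡j = let j<b = <-trans (below last≡j) c<b in
  avoids (a , b , j , ⊆-++-last σ ab⊆σ last≡j (<-trans j<b b<a ∷ j<b ∷ []) , j<b , b<a)

JBelow : ℕ → ℕ → List ℕ → Set
JBelow m k π = IsPerm m π × Avoids321 π × Jacobi π × LastBelow k π

punchIn : ℕ → ℕ → ℕ
punchIn k x with x <? k
... | yes _ = x
... | no _ = suc x

punchOut : ℕ → ℕ → ℕ
punchOut k x with x <? k
... | yes _ = x
... | no _ = pred x

punchIn-< : ∀ {k x} → x < k → punchIn k x ≡ x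
punchIn-< {k} {x} x<k with x <? k
... | yes _ = refl
... | no x≮k = ⊥-elim (x≮k x<k)

punchIn-mono : ∀ k → punchIn k Preserves _<_ ⟶ _<_
punchIn-mono k {x} {y} x<y with x <? k | y <? k
... | yes _ | yes _ = x<y
... | yes _ | no _ = m<n⇒m<1+n x<y
... | no x≮k | yes y<k = ⊥-elim (x≮k (<-trans x<y y<k))
... | no _ | no _ = s<s x<y

punchIn≢ : ∀ k x → punchIn k x ≢ k
punchIn≢ k x with x <? k
... | yes x<k = <⇒≢ x<k
... | no x≮k = λ { refl → x≮k (n<1+n x) }

punchIn-punchOut : ∀ {k x} → x ≢ k → punchIn k (punchOut k x) ≡ x
punchIn-punchOut {k} {x} x≢k with x <? k
... | yes x<k = punchIn-< x<k
punchIn-punchOut {k} {zero} x≢k | no 0≮k = ⊥-elim (x≢k (sym (n≤0⇒n≡0 (≮⇒≥ 0≮k))))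
punchIn-punchOut {k} {suc x} x≢k | no sx≮k with x <? k
... | yes x<k = ⊥-elim (x≢k (≤-antisym x<k (≮⇒≥ sx≮k)))
... | no _ = refl

punchIn-<⇔ : ∀ {k x} → punchIn k x < k ⇔ x < k
punchIn-<⇔ {k} {x} with x <? k
... | yes x<k = mk⇔ (λ _ → x<k) (λ _ → x<k)
... | no x≮k = mk⇔ (λ sx<k → <-trans (n<1+n x) sx<k) (λ x<k → ⊥-elim (x≮k x<k))

punchIn-bounds : ∀ {m k y} → 1 ≤ k → k ≤ suc m →
  (1 ≤ y × y ≤ m) ⇔ (1 ≤ punchIn k y × punchIn k y ≤ suc m)
punchIn-bounds {m} {k} {y} 1≤k k≤1+m with y <? k
... | yes y<k = mk⇔ (λ (1≤y , y≤m) → 1≤y , m≤n⇒m≤1+n y≤m)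
                    (λ (1≤y , _) → 1≤y , ≤-pred (≤-trans y<k k≤1+m))
... | no y≮k = mk⇔ (λ (_ , y≤m) → s≤s z≤n , s≤s y≤m)
                   (λ (_ , y<1+m) → ≤-trans 1≤k (≮⇒≥ y≮k) , ≤-pred y<1+m)

LastBelow-map-punchIn : ∀ {k} π → LastBelow k (map (punchIn k) π) ⇔ LastBelow k π
LastBelow-map-punchIn [] = mk⇔ (λ _ ()) (λ _ ())
LastBelow-map-punchIn {k} (x ∷ []) = mk⇔ forward backward
  where
  forward : LastBelow k (punchIn k x ∷ []) → LastBelow k (x ∷ [])
  forward below refl = Equivalence.to punchIn-<⇔ (below refl)
  backward : LastBelow k (x ∷ []) → LastBelow k (punchIn k x ∷ [])
  backward below refl = Equivalence.from punchIn-<⇔ (below refl)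
LastBelow-map-punchIn (_ ∷ y ∷ π) = LastBelow-map-punchIn (y ∷ π)

extend : ℕ → ℕ → List ℕ → List ℕ
extend m k π = map (punchIn k) π ++ 2 + m ∷ k ∷ []

extend-injective : ∀ m k {π π′} → extend m k π ≡ extend m k π′ → π ≡ π′
extend-injective m k {π} {π′} eq =
  map-injective (injective (punchIn-mono k))
    (++-cancelʳ (2 + m ∷ k ∷ []) (map (punchIn k) π) (map (punchIn k) π′) eq)

module _ {m k : ℕ} (1≤k : 1 ≤ k) (k≤1+m : k ≤ suc m) where

  private
    A = 2 + m
    A≢k : A ≢ k
    A≢k A≡k = <-irrefl (sym A≡k) (s≤s k≤1+m)

  ∈-map-punchIn-bounds : ∀ {π x} → IsPerm′ m π → x ∈ map (punchIn k) π → 1 ≤ x × x ≤ suc m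
  ∈-map-punchIn-bounds perm x∈ with ∈-map⁻ (punchIn k) x∈
  ... | y , y∈π , refl = Equivalence.to (punchIn-bounds 1≤k k≤1+m) (IsPerm′.bounded perm y∈π)

  IsPerm′-extend⁺ : ∀ {π} → IsPerm′ m π → IsPerm′ (2 + m) (extend m k π)
  IsPerm′-extend⁺ {π} perm@(mkPerm unique bounded covers) = mkPerm unique′ bounded′ covers′
    where
    σ = map (punchIn k) π
    σ-bounded : ∀ {x} → x ∈ σ → 1 ≤ x × x ≤ suc m
    σ-bounded = ∈-map-punchIn-bounds perm
    unique′ : Unique (extend m k π)
    unique′ = Unique-++⁺ (Unique-map⁺ (injective (punchIn-mono k)) unique) ((A≢k ∷ []) ∷ [] ∷ [])
      λ { (x∈σ , here refl) → <-irrefl refl (s≤s (proj₂ (σ-bounded x∈σ)))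
        ; (x∈σ , there (here refl)) →
            let y , _ , k≡y↑ = ∈-map⁻ (punchIn k) x∈σ in punchIn≢ k y (sym k≡y↑) }
    bounded′ : ∀ {x} → x ∈ extend m k π → 1 ≤ x × x ≤ 2 + m
    bounded′ x∈ with ∈-++⁻ σ x∈
    ... | inj₁ x∈σ = map₂ m≤n⇒m≤1+n (σ-bounded x∈σ)
    ... | inj₂ (here refl) = s≤s z≤n , ≤-refl
    ... | inj₂ (there (here refl)) = 1≤k , m≤n⇒m≤1+n k≤1+m
    covers′ : ∀ {x} → 1 ≤ x → x ≤ 2 + m → x ∈ extend m k π
    covers′ {x} 1≤x x≤A with x ≟ A | x ≟ k
    ... | yes refl | _ = ∈-++⁺ʳ σ (here refl)
    ... | no _ | yes refl = ∈-++⁺ʳ σ (there (here refl))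
    ... | no x≢A | no x≢k = ∈-++⁺ˡ (subst (_∈ σ) (punchIn-punchOut x≢k) (∈-map⁺ (punchIn k) x↓∈π))
      where
      x↓∈π : punchOut k x ∈ π
      x↓∈π = uncurry covers (Equivalence.from (punchIn-bounds 1≤k k≤1+m)
               (subst (λ y → 1 ≤ y × y ≤ suc m) (sym (punchIn-punchOut x≢k)) (1≤x , ≤-pred (≤∧≢⇒< x≤A x≢A))))

  IsPerm′-extend⁻ : ∀ {π} → IsPerm′ (2 + m) (extend m k π) → IsPerm′ m π
  IsPerm′-extend⁻ {π} (mkPerm unique bounded covers) with Unique-++⁻ (map (punchIn k) π) unique
  ... | unique-σ , _ , disjoint = mkPerm (Unique-map⁻ unique-σ) bounded′ covers′
    where
    σ = map (punchIn k) π
    bounded′ : ∀ {y} → y ∈ π → 1 ≤ y × y ≤ m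
    bounded′ {y} y∈π = Equivalence.from (punchIn-bounds 1≤k k≤1+m) (1≤y↑ , ≤-pred (≤∧≢⇒< y↑≤A y↑≢A))
      where
      y↑∈σ = ∈-map⁺ (punchIn k) y∈π
      1≤y↑ = proj₁ (bounded (∈-++⁺ˡ y↑∈σ))
      y↑≤A = proj₂ (bounded (∈-++⁺ˡ y↑∈σ))
      y↑≢A : punchIn k y ≢ A
      y↑≢A y↑≡A = disjoint (y↑∈σ , here y↑≡A)
    covers′ : ∀ {y} → 1 ≤ y → y ≤ m → y ∈ π
    covers′ {y} 1≤y y≤m with Equivalence.to (punchIn-bounds 1≤k k≤1+m) (1≤y , y≤m)
    ... | 1≤y↑ , y↑≤1+m with ∈-map⁻ (punchIn k) (∈-++-peak⁻ σ (covers 1≤y↑ (m≤n⇒m≤1+n y↑≤1+m))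
                               (λ y↑≡A → <-irrefl y↑≡A (s≤s y↑≤1+m)) (punchIn≢ k y))
    ...   | z , z∈π , y↑≡z↑ = subst (_∈ π) (sym (injective (punchIn-mono k) y↑≡z↑)) z∈π

  extend-correct : ∀ {π} → JBelow m k π ⇔ JLast (2 + m) k (extend m k π)
  extend-correct {π} = mk⇔ forward backward
    where
    open Equivalence using (to; from)
    σ = map (punchIn k) π
    σ<A : IsPerm m π → All (_< 2 + m) σ
    σ<A perm = All.tabulate λ x∈σ → s≤s (proj₂ (∈-map-punchIn-bounds (to IsPerm⇔IsPerm′ perm) x∈σ))
    forward : JBelow m k π → JLast (2 + m) k (extend m k π)
    forward (perm , avoids , jacobi , below) =
      from IsPerm⇔IsPerm′ (IsPerm′-extend⁺ (to IsPerm⇔IsPerm′ perm)) ,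
      Avoids321-++-peak σ (from (Avoids321-map (punchIn-mono k) π) avoids) (σ<A perm) σ-below ,
      from (Jacobi-++-peak σ (σ<A perm) (s≤s k≤1+m) σ-below) (from (Jacobi-map (punchIn-mono k) π) jacobi) ,
      last-++-∷-∷ σ (2 + m) k
      where
      σ-below = from (LastBelow-map-punchIn π) below
    backward : JLast (2 + m) k (extend m k π) → JBelow m k π
    backward (perm , avoids , jacobi , _) =
      from IsPerm⇔IsPerm′ (IsPerm′-extend⁻ (to IsPerm⇔IsPerm′ perm)) ,
      to (Avoids321-map (punchIn-mono k) π) (Avoids321-⊆ (Sublistₚ.++⁺ʳ (2 + m ∷ k ∷ []) ⊆-refl) avoids) ,
      to (Jacobi-map (punchIn-mono k) π) (to (Jacobi-++-peak σ σ<A′ (s≤s k≤1+m) σ-below) jacobi) ,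
      to (LastBelow-map-punchIn π) σ-below
      where
      σ<A′ = σ<A (from IsPerm⇔IsPerm′ (IsPerm′-extend⁻ (to IsPerm⇔IsPerm′ perm)))
      σ-below = LastBelow-peak σ σ<A′ jacobi

JLast-++-∷-∷ : ∀ {m k a b} σ → JLast (2 + m) k (σ ++ a ∷ b ∷ []) → a ≡ 2 + m × b ≡ k
JLast-++-∷-∷ {m} {k} {a} {b} σ (perm , avoids , jacobi , last≡k) = a≡A , b≡k
  where
  open IsPerm′ (Equivalence.to IsPerm⇔IsPerm′ perm)
  A = 2 + m
  b≡k : b ≡ k
  b≡k = just-injective (trans (sym (last-++-∷-∷ σ a b)) last≡k)
  b<a : b < a
  b<a with a <? b | Unique-++⁻ σ unique
  ... | no a≮b | _ , ((a≢b ∷ []) ∷ _) , _ = ≤∧≢⇒< (≮⇒≥ a≮b) (a≢b ∘ sym)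
  ... | yes a<b | _ = ⊥-elim (¬2∣1 (subst (λ r → 2 ∣ length r) (ρ-∷-< [] a<b) (proj₁ (Jacobi-++⁻ʳ σ jacobi))))
  a≤A : a ≤ A
  a≤A = proj₂ (bounded (∈-++⁺ʳ σ (here refl)))
  a≡A : a ≡ A
  a≡A with a ≟ A
  ... | yes a≡A = a≡A
  ... | no a≢A = ⊥-elim (avoids (A , a , b , ∈⇒∷-++-⊆ (a ∷ b ∷ []) A∈σ , b<a , a<A))
    where
    a<A = ≤∧≢⇒< a≤A a≢A
    A∈σ : A ∈ σ
    A∈σ = ∈-++-peak⁻ σ (covers (s≤s z≤n) ≤-refl) (a≢A ∘ sym) (λ A≡b → <-asym (subst (_< a) (sym A≡b) b<a) a<A)

JLast-peak : ∀ {m k π} → JLast (2 + m) k π → ∃ λ σ → π ≡ σ ++ 2 + m ∷ k ∷ []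
JLast-peak {π = []} (perm , _) with ↭-length perm
... | ()
JLast-peak {π = _ ∷ []} (perm , _) with ↭-length perm
... | ()
JLast-peak {m} {k} {x ∷ y ∷ r} jlast with ∷-∷-as-++ x y r
... | σ , a , b , eq with JLast-++-∷-∷ σ (subst (JLast (2 + m) k) eq jlast)
... | refl , refl = σ , eq

JLast⇒extend : ∀ {m k π} → JLast (2 + m) k π → 1 ≤ k × k ≤ suc m × ∃ λ π′ → π ≡ extend m k π′
JLast⇒extend {m} {k} jlast@(perm , _) with JLast-peak jlast
... | σ , refl =
  1≤k , ≤-pred (≤∧≢⇒< k≤A (A≢k ∘ sym)) , map (punchOut k) σ , cong (_++ _) (sym punchIn-punchOut-σ)
  where
  open IsPerm′ (Equivalence.to IsPerm⇔IsPerm′ perm)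
  k∈ = ∈-++⁺ʳ σ (there (here refl))
  1≤k = proj₁ (bounded k∈)
  k≤A = proj₂ (bounded k∈)
  A≢k : 2 + m ≢ k
  A≢k with Unique-++⁻ σ unique
  ... | _ , ((A≢k ∷ []) ∷ _) , _ = A≢k
  σ≢k : All (_≢ k) σ
  σ≢k with Unique-++⁻ σ unique
  ... | _ , _ , disjoint = All.tabulate λ x∈σ x≡k → disjoint (x∈σ , there (here x≡k))
  punchIn-punchOut-σ : map (punchIn k) (map (punchOut k) σ) ≡ σ
  punchIn-punchOut-σ = trans (sym (map-∘ σ)) (map-id-local (All.map punchIn-punchOut σ≢k))

mutual
  jacobiLast : ℕ → ℕ → List (List ℕ)
  jacobiLast zero k = []
  jacobiLast (suc zero) k with k ≟ 1
  ... | yes _ = (1 ∷ []) ∷ []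
  ... | no _ = []
  jacobiLast (suc (suc m)) k with 1 ≤? k ×-dec k ≤? suc m
  ... | yes _ = map (extend m k) (jacobiBelow m k)
  ... | no _ = []

  jacobiBelow : ℕ → ℕ → List (List ℕ)
  jacobiBelow zero b = [] ∷ []
  jacobiBelow (suc m) zero = []
  jacobiBelow (suc m) (suc b) = jacobiBelow (suc m) b ++ jacobiLast (suc m) b

mutual
  ∈-jacobiLast⁻ : ∀ m k {π} → π ∈ jacobiLast m k → JLast m k π
  ∈-jacobiLast⁻ (suc zero) k π∈ with k ≟ 1
  ∈-jacobiLast⁻ (suc zero) k (here refl) | yes refl =
    ↭-refl , Avoids321-short (s≤s (s≤s z≤n)) , (divides 0 refl , tt) , refl
  ∈-jacobiLast⁻ (suc (suc m)) k π∈ with 1 ≤? k ×-dec k ≤? suc m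
  ... | yes (1≤k , k≤1+m) with ∈-map⁻ (extend m k) π∈
  ...   | π′ , π′∈ , refl = Equivalence.to (extend-correct 1≤k k≤1+m) (∈-jacobiBelow⁻ m k π′∈)

  ∈-jacobiLast⁺ : ∀ m k {π} → JLast m k π → π ∈ jacobiLast m k
  ∈-jacobiLast⁺ zero k (perm , _ , _ , last≡k) with ↭-empty-inv perm
  ∈-jacobiLast⁺ zero k (_ , _ , _ , ()) | refl
  ∈-jacobiLast⁺ (suc zero) k (perm , _ , _ , last≡k) with ↭-singleton-inv perm
  ∈-jacobiLast⁺ (suc zero) k (_ , _ , _ , refl) | refl with k ≟ 1
  ... | yes _ = here refl
  ... | no k≢1 = ⊥-elim (k≢1 refl)
  ∈-jacobiLast⁺ (suc (suc m)) k jlast with JLast⇒extend jlast | 1 ≤? k ×-dec k ≤? suc m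
  ... | 1≤k , k≤1+m , π′ , refl | yes _ =
    ∈-map⁺ (extend m k) (∈-jacobiBelow⁺ m k (Equivalence.from (extend-correct 1≤k k≤1+m) jlast))
  ... | 1≤k , k≤1+m , _ | no out = ⊥-elim (out (1≤k , k≤1+m))

  ∈-jacobiBelow⁻ : ∀ m b {π} → π ∈ jacobiBelow m b → JBelow m b π
  ∈-jacobiBelow⁻ zero b (here refl) = ↭-refl , Avoids321-short (s≤s z≤n) , tt , λ ()
  ∈-jacobiBelow⁻ (suc m) (suc b) π∈ with ∈-++⁻ (jacobiBelow (suc m) b) π∈
  ... | inj₁ π∈below with ∈-jacobiBelow⁻ (suc m) b π∈below
  ...   | perm , avoids , jacobi , below = perm , avoids , jacobi , m<n⇒m<1+n ∘ below
  ∈-jacobiBelow⁻ (suc m) (suc b) π∈ | inj₂ π∈last with ∈-jacobiLast⁻ (suc m) b π∈last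
  ...   | perm , avoids , jacobi , last≡b =
    perm , avoids , jacobi , λ last≡j → s≤s (≤-reflexive (just-injective (trans (sym last≡j) last≡b)))

  ∈-jacobiBelow⁺ : ∀ m b {π} → JBelow m b π → π ∈ jacobiBelow m b
  ∈-jacobiBelow⁺ zero b (perm , _) with ↭-empty-inv perm
  ... | refl = here refl
  ∈-jacobiBelow⁺ (suc m) zero (perm , _ , _ , below) with last-nonempty perm
  ... | _ , last≡j = ⊥-elim (n≮0 (below last≡j))
  ∈-jacobiBelow⁺ (suc m) (suc b) {π} (perm , avoids , jacobi , below) with last-nonempty perm
  ... | j , last≡j with j ≟ b
  ...   | yes refl = ∈-++⁺ʳ (jacobiBelow (suc m) j) (∈-jacobiLast⁺ (suc m) j (perm , avoids , jacobi , last≡j))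
  ...   | no j≢b = ∈-++⁺ˡ (∈-jacobiBelow⁺ (suc m) b (perm , avoids , jacobi , below′))
    where
    below′ : LastBelow b π
    below′ last≡i = ≤∧≢⇒< (≤-pred (below last≡i))
      λ i≡b → j≢b (trans (just-injective (trans (sym last≡j) last≡i)) i≡b)

mutual
  jacobiLast-unique : ∀ m k → Unique (jacobiLast m k)
  jacobiLast-unique zero k = []
  jacobiLast-unique (suc zero) k with k ≟ 1
  ... | yes _ = [] ∷ []
  ... | no _ = []
  jacobiLast-unique (suc (suc m)) k with 1 ≤? k ×-dec k ≤? suc m
  ... | yes _ = Unique-map⁺ (extend-injective m k) (jacobiBelow-unique m k)
  ... | no _ = []

  jacobiBelow-unique : ∀ m b → Unique (jacobiBelow m b)
  jacobiBelow-unique zero b = [] ∷ []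
  jacobiBelow-unique (suc m) zero = []
  jacobiBelow-unique (suc m) (suc b) = Unique-++⁺ (jacobiBelow-unique (suc m) b) (jacobiLast-unique (suc m) b)
    λ (π∈below , π∈last) →
      let _ , _ , _ , below = ∈-jacobiBelow⁻ (suc m) b π∈below
          _ , _ , _ , last≡b = ∈-jacobiLast⁻ (suc m) b π∈last
      in <-irrefl refl (below last≡b)

jLast : ℕ → ℕ → ℕ
jLast m k = length (jacobiLast m k)

JLast-card : ∀ m k → HasCard (JLast m k) (jLast m k)
JLast-card m k = jacobiLast m k , jacobiLast-unique m k ,
                 (λ π → mk⇔ (∈-jacobiLast⁻ m k) (∈-jacobiLast⁺ m k)) , refl

-- The counting recurrence

jBelow : ℕ → ℕ → ℕ
jBelow m b = length (jacobiBelow m b)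

jLast-inside : ∀ {m k} → 1 ≤ k → k ≤ suc m → jLast (2 + m) k ≡ jBelow m k
jLast-inside {m} {k} 1≤k k≤1+m with 1 ≤? k ×-dec k ≤? suc m
... | yes _ = length-map (extend m k) (jacobiBelow m k)
... | no out = ⊥-elim (out (1≤k , k≤1+m))

jLast-outside : ∀ {m k} → ¬ (1 ≤ k × k ≤ suc m) → jLast (2 + m) k ≡ 0
jLast-outside {m} {k} out with 1 ≤? k ×-dec k ≤? suc m
... | yes inside = ⊥-elim (out inside)
... | no _ = refl

jLast-zero : ∀ m → jLast (suc m) 0 ≡ 0
jLast-zero zero = refl
jLast-zero (suc m) = jLast-outside {m} {0} λ { (() , _) }

jBelow-suc : ∀ m b → jBelow (suc m) (suc b) ≡ jBelow (suc m) b + jLast (suc m) b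
jBelow-suc m b = length-++ (jacobiBelow (suc m) b)

-- Binomial identities

absorption : ∀ n k → suc k * (suc n C suc k) ≡ suc n * (n C k)
absorption zero zero = refl
absorption zero (suc k) = *-zeroʳ (suc (suc k))
absorption (suc n) zero = trans (+-identityʳ _) (trans (nC1≡n (suc (suc n))) (sym (*-identityʳ (suc (suc n)))))
absorption (suc n) (suc k) = begin
  suc (suc k) * (suc (suc n) C suc (suc k))          ≡⟨ cong (suc (suc k) *_) (nCk+nC[k+1]≡[n+1]C[k+1] (suc n) (suc k)) ⟨
  suc (suc k) * (a + b)                               ≡⟨ *-distribˡ-+ (suc (suc k)) a b ⟩
  (a + suc k * a) + suc (suc k) * b                   ≡⟨ cong₂ (λ x y → (a + x) + y) (absorption n k) (absorption n (suc k)) ⟩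
  (a + suc n * (n C k)) + suc n * (n C suc k)         ≡⟨ +-assoc a _ _ ⟩
  a + (suc n * (n C k) + suc n * (n C suc k))         ≡⟨ cong (a +_) (*-distribˡ-+ (suc n) (n C k) (n C suc k)) ⟨
  a + suc n * (n C k + n C suc k)                     ≡⟨ cong (λ x → a + suc n * x) (nCk+nC[k+1]≡[n+1]C[k+1] n k) ⟩
  a + suc n * a                                       ∎
  where
  open ≡-Reasoning
  a = suc n C suc k
  b = suc n C suc (suc k)

[k+1]*nC[k+1]≡[n∸k]*nCk : ∀ {n k} → k ≤ n → suc k * (n C suc k) ≡ (n ∸ k) * (n C k)
[k+1]*nC[k+1]≡[n∸k]*nCk {n} {k} k≤n = +-cancelˡ-≡ (suc k * (n C k)) _ _ (begin
  suc k * (n C k) + suc k * (n C suc k)   ≡⟨ *-distribˡ-+ (suc k) (n C k) (n C suc k) ⟨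
  suc k * (n C k + n C suc k)             ≡⟨ cong (suc k *_) (nCk+nC[k+1]≡[n+1]C[k+1] n k) ⟩
  suc k * (suc n C suc k)                 ≡⟨ absorption n k ⟩
  suc n * (n C k)                         ≡⟨ cong (λ m → suc m * (n C k)) (m+[n∸m]≡n k≤n) ⟨
  (suc k + (n ∸ k)) * (n C k)             ≡⟨ *-distribʳ-+ (n C k) (suc k) (n ∸ k) ⟩
  suc k * (n C k) + (n ∸ k) * (n C k)     ∎)
  where open ≡-Reasoning

ballot : ∀ {p K x} → p ≤ K → x + K C suc p ≡ K C p → suc p * x ≡ (2 * suc p ∸ suc K) * (K C p)
ballot {p} {K} {x} p≤K x+e≡c = begin
  suc p * x                           ≡⟨ m+n∸n≡m (suc p * x) (d * c) ⟨
  suc p * x + d * c ∸ d * c           ≡⟨ cong (λ y → suc p * x + y ∸ d * c) ([k+1]*nC[k+1]≡[n∸k]*nCk p≤K) ⟨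
  suc p * x + suc p * e ∸ d * c       ≡⟨ cong (_∸ d * c) (*-distribˡ-+ (suc p) x e) ⟨
  suc p * (x + e) ∸ d * c             ≡⟨ cong (λ y → suc p * y ∸ d * c) x+e≡c ⟩
  suc p * c ∸ d * c                   ≡⟨ *-distribʳ-∸ c (suc p) d ⟨
  (suc p ∸ d) * c                     ≡⟨ cong (_* c) 2[p+1]∸[K+1]≡p+1∸d ⟨
  (2 * suc p ∸ suc K) * c             ∎
  where
  open ≡-Reasoning
  c = K C p
  e = K C suc p
  d = K ∸ p
  2[p+1]∸[K+1]≡p+1∸d : 2 * suc p ∸ suc K ≡ suc p ∸ d
  2[p+1]∸[K+1]≡p+1∸d = begin
    2 * suc p ∸ suc K              ≡⟨ cong₂ _∸_ (cong (suc p +_) (+-identityʳ (suc p))) (cong suc (sym (m+[n∸m]≡n p≤K))) ⟩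
    suc p + suc p ∸ (suc p + d)    ≡⟨ [m+n]∸[m+o]≡n∸o (suc p) (suc p) d ⟩
    suc p ∸ d                      ∎

[2n+1]C[n+1]≡[2n+1]Cn : ∀ n → suc (2 * n) C suc n ≡ suc (2 * n) C n
[2n+1]C[n+1]≡[2n+1]Cn n =
  sym (trans (nCk≡nC[n∸k] (m≤n⇒m≤1+n (m≤m+n n (n + 0)))) (cong (suc (2 * n) C_) 2n+1∸n≡n+1))
  where
  2n+1∸n≡n+1 : suc (2 * n) ∸ n ≡ suc n
  2n+1∸n≡n+1 = trans (cong (λ m → suc (n + m) ∸ n) (+-identityʳ n)) (m+n∸n≡m (suc n) n)

-- Solving the recurrence

-- j(2n,k) = C(k-1,n-1) − C(k-1,n), stated without truncated subtraction.
mutual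
  jLast-even : ∀ p k → 1 ≤ k → k ≤ 2 * suc p → jLast (2 * suc p) k + (k ∸ 1) C suc p ≡ (k ∸ 1) C p
  jLast-even zero 1 _ _ = refl
  jLast-even zero 2 _ _ = refl
  jLast-even zero (suc (suc (suc _))) _ (s≤s (s≤s ()))
  jLast-even (suc p) k 1≤k k≤2[p+2] with k ≤? suc (2 * suc p)
  ... | yes k≤2p+3 = begin
    jLast (2 * suc (suc p)) k + (k ∸ 1) C suc (suc p)  ≡⟨ cong (λ m → jLast m k + (k ∸ 1) C suc (suc p)) (*-suc 2 (suc p)) ⟩
    jLast (2 + 2 * suc p) k + (k ∸ 1) C suc (suc p)    ≡⟨ cong (_+ (k ∸ 1) C suc (suc p)) (jLast-inside 1≤k k≤2p+3) ⟩
    jBelow (2 * suc p) k + (k ∸ 1) C suc (suc p)       ≡⟨ jBelow-even p k k≤2p+3 ⟩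
    (k ∸ 1) C suc p                                    ∎
    where open ≡-Reasoning
  ... | no k≰2p+3 with ≤-antisym (subst (k ≤_) (*-suc 2 (suc p)) k≤2[p+2]) (≰⇒> k≰2p+3)
  ...   | refl = trans (cong (_+ suc (2 * suc p) C suc (suc p)) jLast≡0) ([2n+1]C[n+1]≡[2n+1]Cn (suc p))
    where
    jLast≡0 : jLast (2 * suc (suc p)) k ≡ 0
    jLast≡0 = trans (cong (λ m → jLast m k) (*-suc 2 (suc p))) (jLast-outside (λ (_ , k≤) → k≰2p+3 k≤))

  jBelow-even : ∀ p b → b ≤ suc (2 * suc p) →
    jBelow (2 * suc p) b + (b ∸ 1) C suc (suc p) ≡ (b ∸ 1) C suc p
  jBelow-even p zero _ = refl
  jBelow-even p (suc zero) _ = cong (_+ 0) (jLast-zero (pred (2 * suc p)))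
  jBelow-even p (suc (suc b)) b+2≤ = begin
    jBelow m (2 + b) + suc b C suc (suc p)
      ≡⟨ cong₂ _+_ (jBelow-suc _ (suc b)) (sym (nCk+nC[k+1]≡[n+1]C[k+1] b (suc p))) ⟩
    (jBelow m (suc b) + jLast m (suc b)) + (b C suc p + b C suc (suc p))
      ≡⟨ cong (jBelow m (suc b) + jLast m (suc b) +_) (+-comm (b C suc p) _) ⟩
    (jBelow m (suc b) + jLast m (suc b)) + (b C suc (suc p) + b C suc p)
      ≡⟨ interchange (jBelow m (suc b)) (jLast m (suc b)) _ _ ⟩
    (jBelow m (suc b) + b C suc (suc p)) + (jLast m (suc b) + b C suc p)
      ≡⟨ cong₂ _+_ (jBelow-even p (suc b) (m≤n⇒m≤1+n (≤-pred b+2≤))) (jLast-even p (suc b) (s≤s z≤n) (≤-pred b+2≤)) ⟩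
    b C suc p + b C p
      ≡⟨ +-comm (b C suc p) (b C p) ⟩
    b C p + b C suc p
      ≡⟨ nCk+nC[k+1]≡[n+1]C[k+1] b p ⟩
    suc b C suc p
      ∎
    where
    open ≡-Reasoning
    m = 2 * suc p

jLast-even-inside : ∀ n k → 1 ≤ n → n ≤ k × k ≤ 2 * n ∸ 1 →
  n * jLast (2 * n) k ≡ (2 * n ∸ k) * ((k ∸ 1) C (n ∸ 1))
jLast-even-inside (suc p) (suc K) _ (s≤s p≤K , k≤) =
  ballot p≤K (jLast-even p (suc K) (s≤s z≤n) (≤-trans k≤ (m∸n≤m _ 1)))

jLast-even-outside : ∀ n k → 1 ≤ n → ¬ (n ≤ k × k ≤ 2 * n ∸ 1) → jLast (2 * n) k ≡ 0
jLast-even-outside (suc p) zero _ _ = jLast-zero (pred (2 * suc p))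
jLast-even-outside (suc p) (suc K) _ out with suc K ≤? 2 * suc p ∸ 1
... | no k≰ = trans (cong (λ m → jLast m (suc K)) (*-suc 2 p))
                    (jLast-outside (λ (_ , k≤) → k≰ (subst (suc K ≤_) (sym (cong (_∸ 1) (*-suc 2 p))) k≤)))
... | yes k≤ =
  m+n≡0⇒m≡0 _ (trans (jLast-even p (suc K) (s≤s z≤n) (≤-trans k≤ (m∸n≤m _ 1))) (k>n⇒nCk≡0 K<p))
  where
  K<p : K < p
  K<p = ≤-pred (≰⇒> (λ n≤k → out (n≤k , k≤)))

jBelow-shift : ∀ m → (∀ k → jLast (2 + m) (suc k) ≡ jLast (suc m) k) →
  ∀ k → jBelow (2 + m) (suc k) ≡ jBelow (suc m) k
jBelow-shift m shift zero = jLast-zero (suc m)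
jBelow-shift m shift (suc k) = begin
  jBelow (2 + m) (2 + k)                            ≡⟨ jBelow-suc (suc m) (suc k) ⟩
  jBelow (2 + m) (suc k) + jLast (2 + m) (suc k)    ≡⟨ cong₂ _+_ (jBelow-shift m shift k) (shift k) ⟩
  jBelow (suc m) k + jLast (suc m) k                ≡⟨ jBelow-suc m k ⟨
  jBelow (suc m) (suc k)                            ∎
  where open ≡-Reasoning

jLast-shift-step : ∀ m → (∀ k → jLast (2 + m) (suc k) ≡ jLast (suc m) k) →
  ∀ k → jLast (4 + m) (suc k) ≡ jLast (3 + m) k
jLast-shift-step m shift zero =
  trans (jLast-inside {2 + m} (s≤s z≤n) (s≤s z≤n)) (trans (jBelow-shift m shift 0) (sym (jLast-zero (2 + m))))
jLast-shift-step m shift (suc k) with ≤-<-connex (suc k) (2 + m)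
... | inj₁ k+1≤m+2 = begin
  jLast (4 + m) (2 + k)     ≡⟨ jLast-inside (s≤s z≤n) (s≤s k+1≤m+2) ⟩
  jBelow (2 + m) (2 + k)    ≡⟨ jBelow-shift m shift (suc k) ⟩
  jBelow (suc m) (suc k)    ≡⟨ jLast-inside (s≤s z≤n) k+1≤m+2 ⟨
  jLast (3 + m) (suc k)     ∎
  where open ≡-Reasoning
... | inj₂ m+2<k+1 = trans (jLast-outside {2 + m} (λ (_ , k+2≤m+3) → <⇒≱ m+2<k+1 (≤-pred k+2≤m+3)))
                          (sym (jLast-outside {suc m} (λ (_ , k+1≤m+2) → <⇒≱ m+2<k+1 k+1≤m+2)))

jLast-odd-shift : ∀ p k → jLast (suc (2 * suc p)) (suc k) ≡ jLast (2 * suc p) k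
jLast-odd-shift zero 0 = refl
jLast-odd-shift zero 1 = refl
jLast-odd-shift zero (suc (suc k)) = trans (jLast-outside {1} {3 + k} (λ { (_ , s≤s (s≤s ())) }))
                                           (sym (jLast-outside {0} {2 + k} (λ { (_ , s≤s ()) })))
jLast-odd-shift (suc p) k = subst (λ m → jLast (suc m) (suc k) ≡ jLast m k) (sym (*-suc 2 (suc p)))
                                  (jLast-shift-step _ (jLast-odd-shift p) k)

jLast-odd : ∀ n k → 1 ≤ n → jLast (2 * n + 1) (suc k) ≡ jLast (2 * n) k
jLast-odd (suc p) k _ = trans (cong (λ m → jLast m (suc k)) (+-comm (2 * suc p) 1)) (jLast-odd-shift p k)

jLast-odd-inside : ∀ n k → 1 ≤ n → n + 1 ≤ k × k ≤ 2 * n →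
  n * jLast (2 * n + 1) k ≡ (2 * n + 1 ∸ k) * ((k ∸ 2) C (n ∸ 1))
jLast-odd-inside (suc p) zero _ (n+1≤0 , _) = ⊥-elim (n≮0 (subst (_≤ 0) (+-comm (suc p) 1) n+1≤0))
jLast-odd-inside n@(suc p) (suc k) 1≤n (n+1≤k+1 , s≤s k<2n) = begin
  n * jLast (2 * n + 1) (suc k)             ≡⟨ cong (n *_) (jLast-odd n k 1≤n) ⟩
  n * jLast (2 * n) k                       ≡⟨ jLast-even-inside n k 1≤n (n≤k , k<2n) ⟩
  (2 * n ∸ k) * ((k ∸ 1) C p)               ≡⟨ cong (λ m → (m ∸ suc k) * ((k ∸ 1) C p)) (+-comm (2 * n) 1) ⟨
  (2 * n + 1 ∸ suc k) * ((k ∸ 1) C p)       ∎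
  where
  open ≡-Reasoning
  n≤k = ≤-pred (subst (_≤ suc k) (+-comm n 1) n+1≤k+1)

jLast-odd-outside : ∀ n k → 1 ≤ n → ¬ (n + 1 ≤ k × k ≤ 2 * n) → jLast (2 * n + 1) k ≡ 0
jLast-odd-outside n zero _ _ = trans (cong (λ m → jLast m 0) (+-comm (2 * n) 1)) (jLast-zero (2 * n))
jLast-odd-outside n@(suc p) (suc k) 1≤n out = trans (jLast-odd n k 1≤n) (jLast-even-outside n k 1≤n
  λ (n≤k , k<2n) → out (subst (_≤ suc k) (+-comm 1 n) (s≤s n≤k) , s≤s k<2n))

theorem7p9 : (n k : ℕ) → 1 ≤ n →
    (Σ ℕ λ N → HasCard (JLast (2 * n) k) N
      × ((n ≤ k × k ≤ 2 * n ∸ 1) → n * N ≡ (2 * n ∸ k) * ((k ∸ 1) C (n ∸ 1)))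
      × (¬ (n ≤ k × k ≤ 2 * n ∸ 1) → N ≡ 0))
    × (Σ ℕ λ N → HasCard (JLast (2 * n + 1) k) N
      × ((n + 1 ≤ k × k ≤ 2 * n) → n * N ≡ (2 * n + 1 ∸ k) * ((k ∸ 2) C (n ∸ 1)))
      × (¬ (n + 1 ≤ k × k ≤ 2 * n) → N ≡ 0))
theorem7p9 n k 1≤n =
  (jLast (2 * n) k , JLast-card (2 * n) k , jLast-even-inside n k 1≤n , jLast-even-outside n k 1≤n) ,
  (jLast (2 * n + 1) k , JLast-card (2 * n + 1) k , jLast-odd-inside n k 1≤n , jLast-odd-outside n k 1≤n)
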